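{- If $F$ is a flat of a (loopless) polymatroid $P$ on $E=\{1,\dots,n\}$, then the minimal multisymmetric lift of the restriction $P|_F$ equals the restriction $\widetilde P|_{\pi^{ -1}(F)}$ of the minimal multisymmetric lift $\widetilde P$ of $P$.
   Context: A polymatroid on a finite set $E$ is a function $\mathrm{rk}:2^E\to\mathbb Z_{\ge0}$ that is submodular, monotone, $\mathrm{rk}(\emptyset)=0$, and loopless. A flat is a subset maximal among subsets of its rank. The restriction $P|_F$ is the polymatroid on $F$ with $\mathrm{rk}_{P|_F}(A)=\mathrm{rk}_P(A)$; similarly for matroids. The minimal multisymmetric lift $\widetilde P$ is the matroid on $\widetilde E=\widetilde E_1\sqcup\cdots\sqcup\widetilde E_n$, $\widetilde E_i=\{1,\dots,\mathrm{rk}_P(i)\}$ (disjoint), with $\pi:\widetilde E\to E$, $\pi^{ -1}(i)=\widetilde E_i$, and $\mathrm{rk}_{\widetilde P}(S)=\min_{A\subseteq E}(\mathrm{rk}_P(A)+|S\setminus\pi^{ -1}(A)|)$. The minimal lift of $P|_F$ is accordingly a matroid on $\bigsqcup_{i\in F}\widetilde E_i=\pi^{ -1}(F)$. -}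

module Defs where

open import Data.Bool using (Bool; true; false; if_then_else_)
open import Data.Nat using (ℕ; zero; suc; _+_; _≤_; _<_; _⊓_)
open import Data.Fin using (Fin)
open import Data.Fin.Subset using (Subset; ⊥; ⊤; ⁅_⁆; _∈_; _⊆_; _∪_; _∩_)
open import Data.Vec using (Vec; []; _∷_; lookup)
open import Data.Product using (Σ; _,_)
open import Relation.Binary.PropositionalEquality using (_≡_)

record Polymatroid (n : ℕ) : Set where
  field
    rk          : Subset n → ℕ
    rk-empty    : rk ⊥ ≡ 0
    monotone    : ∀ {A B} → A ⊆ B → rk A ≤ rk B
    submodular  : ∀ A B → rk (A ∪ B) + rk (A ∩ B) ≤ rk A + rk B
    loopless    : ∀ i → 0 < rk ⁅ i ⁆
open Polymatroid public

IsFlat : ∀ {n} → Polymatroid n → Subset n → Set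
IsFlat P F = ∀ G → F ⊆ G → rk P G ≡ rk P F → G ≡ F

sumFin : (m : ℕ) → (Fin m → ℕ) → ℕ
sumFin zero    f = 0
sumFin (suc m) f = f Fin.zero + sumFin m (λ j → f (Fin.suc j))
  where import Data.Fin as Fin

minOver : ∀ {n} → (G : Subset n) → (Subset n → ℕ) → ℕ
minOver {zero}  []           f = f []
minOver {suc n} (false ∷ G)  f = minOver G (λ A → f (false ∷ A))
minOver {suc n} (true  ∷ G)  f =
  minOver G (λ A → f (false ∷ A)) ⊓ minOver G (λ A → f (true ∷ A))

-- The lifted ground set Ẽ = ⊔_i Ẽ_i with Ẽ_i = {1..rk(i)}; an element is (i , j)
-- with j : Fin (rk {i}), and π (i , j) = i.
Ẽ : ∀ {n} → Polymatroid n → Set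
Ẽ {n} P = Σ (Fin n) (λ i → Fin (rk P ⁅ i ⁆))

π : ∀ {n} {P : Polymatroid n} → Ẽ P → Fin n
π (i , _) = i

LSubset : ∀ {n} → Polymatroid n → Set
LSubset P = Ẽ P → Bool

_∈L_ : ∀ {n} {P : Polymatroid n} → Ẽ P → LSubset P → Set
_∈L_ x S = S x ≡ true

countOutside : ∀ {n} (P : Polymatroid n) → LSubset P → Subset n → ℕ
countOutside {n} P S A =
  sumFin n (λ i → if lookup A i then 0
                  else sumFin (rk P ⁅ i ⁆) (λ j → if S (i , j) then 1 else 0))

-- Rank function of the minimal multisymmetric lift of the polymatroid
-- (rk P restricted to the ground set G ⊆ E, i.e. P|_G), evaluated on
-- S ⊆ π⁻¹(G):  min_{A ⊆ G} ( rk(A) + |S \ π⁻¹(A)| ).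
-- Note rk_{P|G}(i) = rk_P(i) for i ∈ G, so the lifted ground set of P|_G
-- is exactly π⁻¹(G) ⊆ Ẽ.
liftRankOn : ∀ {n} (P : Polymatroid n) (G : Subset n) → LSubset P → ℕ
liftRankOn P G S = minOver G (λ A → rk P A + countOutside P S A)

liftRank : ∀ {n} (P : Polymatroid n) → LSubset P → ℕ
liftRank P = liftRankOn P ⊤

liftRestrictRank : ∀ {n} (P : Polymatroid n) (F : Subset n) → LSubset P → ℕ
liftRestrictRank P F = liftRankOn P F

_⊆π⁻¹_ : ∀ {n} {P : Polymatroid n} → LSubset P → Subset n → Set
_⊆π⁻¹_ {P = P} S F = ∀ (x : Ẽ P) → _∈L_ {P = P} x S → π {P = P} x ∈ F

{-# OPTIONS --safe #-}
-- For S ⊆ π⁻¹(F) the term |S ∖ π⁻¹(A)| only depends on A ∩ F, while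
-- rk(A ∩ F) ≤ rk(A); so the minimum of rk(A) + |S ∖ π⁻¹(A)| over all A ⊆ E
-- is already attained on some A ⊆ F, i.e. equals the rank of S in the minimal
-- lift of P|_F.
module Submission where

open import Defs
open import Data.Nat using (ℕ; zero; suc; _+_; _≤_)
open import Data.Nat.Properties using (≤-refl; ≤-trans; ≤-reflexive; ≤-antisym; m⊓n≤m; m⊓n≤n; ⊓-glb; +-mono-≤)
open import Data.Bool using (true; false; if_then_else_; _∧_)
open import Data.Fin using (Fin)
open import Data.Fin.Subset using (Subset; _∩_; _⊆_; ⊤; ⁅_⁆)
open import Data.Fin.Subset.Properties using (p∩q⊆p; p∩q⊆q; ⊆⊤; drop-∷-⊆; out⊆; in⊆in)
open import Data.Vec using ([]; _∷_; lookup; here)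
open import Data.Vec.Properties using (lookup-zipWith; []=⇒lookup)
open import Data.Product using (_,_)
open import Relation.Binary.PropositionalEquality using (_≡_; refl; sym; trans; cong₂)

sumFin-cong : ∀ m {f g : Fin m → ℕ} → (∀ i → f i ≡ g i) → sumFin m f ≡ sumFin m g
sumFin-cong zero    f≗g = refl
sumFin-cong (suc m) f≗g = cong₂ _+_ (f≗g Fin.zero) (sumFin-cong m (λ j → f≗g (Fin.suc j)))
  where import Data.Fin as Fin

sumFin-zero : ∀ m {f : Fin m → ℕ} → (∀ i → f i ≡ 0) → sumFin m f ≡ 0
sumFin-zero zero    f≗0 = refl
sumFin-zero (suc m) f≗0 = cong₂ _+_ (f≗0 Fin.zero) (sumFin-zero m (λ j → f≗0 (Fin.suc j)))
  where import Data.Fin as Fin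

minOver-≤ : ∀ {n} (G : Subset n) (f : Subset n → ℕ) {A} → A ⊆ G → minOver G f ≤ f A
minOver-≤ []          f {[]}        A⊆G = ≤-refl
minOver-≤ (false ∷ G) f {false ∷ A} A⊆G = minOver-≤ G _ (drop-∷-⊆ A⊆G)
minOver-≤ (false ∷ G) f {true  ∷ A} A⊆G with A⊆G here
... | ()
minOver-≤ (true  ∷ G) f {false ∷ A} A⊆G = ≤-trans (m⊓n≤m _ _) (minOver-≤ G _ (drop-∷-⊆ A⊆G))
minOver-≤ (true  ∷ G) f {true  ∷ A} A⊆G = ≤-trans (m⊓n≤n _ _) (minOver-≤ G _ (drop-∷-⊆ A⊆G))

minOver-greatest : ∀ {n} (G : Subset n) (f : Subset n → ℕ) {m} →
  (∀ A → A ⊆ G → m ≤ f A) → m ≤ minOver G f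
minOver-greatest []          f m≤f = m≤f [] (λ ())
minOver-greatest (false ∷ G) f m≤f = minOver-greatest G _ (λ A A⊆G → m≤f (false ∷ A) (out⊆ A⊆G))
minOver-greatest (true  ∷ G) f m≤f =
  ⊓-glb (minOver-greatest G _ (λ A A⊆G → m≤f (false ∷ A) (out⊆ A⊆G)))
        (minOver-greatest G _ (λ A A⊆G → m≤f (true  ∷ A) (in⊆in A⊆G)))

minOver-antimono : ∀ {n} {G H : Subset n} (f : Subset n → ℕ) → G ⊆ H → minOver H f ≤ minOver G f
minOver-antimono {G = G} {H} f G⊆H = minOver-greatest G f (λ A A⊆G → minOver-≤ H f (λ x∈A → G⊆H (A⊆G x∈A)))

fiberCount : ∀ {n} (P : Polymatroid n) → LSubset P → Fin n → ℕ
fiberCount P S i = sumFin (rk P ⁅ i ⁆) (λ j → if S (i , j) then 1 else 0)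

fiberCount-outside : ∀ {n} (P : Polymatroid n) {F : Subset n} {S : LSubset P} →
  _⊆π⁻¹_ {P = P} S F → ∀ {i} → lookup F i ≡ false → fiberCount P S i ≡ 0
fiberCount-outside P {F} {S} S⊆π⁻¹F {i} i∉F = sumFin-zero (rk P ⁅ i ⁆) indicator-zero
  where
  indicator-zero : ∀ j → (if S (i , j) then 1 else 0) ≡ 0
  indicator-zero j with S (i , j) in ij∈S
  ... | false = refl
  ... | true with trans (sym ([]=⇒lookup (S⊆π⁻¹F (i , j) ij∈S))) i∉F
  ...   | ()

countOutside-∩ : ∀ {n} (P : Polymatroid n) {F : Subset n} {S : LSubset P} →
  _⊆π⁻¹_ {P = P} S F → ∀ A → countOutside P S (A ∩ F) ≡ countOutside P S A
countOutside-∩ {n} P {F} {S} S⊆π⁻¹F A = sumFin-cong n summand-∩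
  where
  summand-∩ : ∀ i → (if lookup (A ∩ F) i then 0 else fiberCount P S i)
                  ≡ (if lookup A i then 0 else fiberCount P S i)
  summand-∩ i rewrite lookup-zipWith _∧_ i A F with lookup A i | lookup F i in i∈F
  ... | false | _     = refl
  ... | true  | true  = refl
  ... | true  | false = fiberCount-outside P S⊆π⁻¹F i∈F

lemma2p14 : ∀ {n : ℕ} (P : Polymatroid n) (F : Subset n) → IsFlat P F →
    ∀ (S : LSubset P) → _⊆π⁻¹_ {P = P} S F →
    liftRestrictRank P F S ≡ liftRank P S
lemma2p14 P F _ S S⊆π⁻¹F = ≤-antisym restrict≤lift (minOver-antimono cost ⊆⊤)
  where
  cost : Subset _ → ℕ
  cost A = rk P A + countOutside P S A

  cost-∩ : ∀ A → cost (A ∩ F) ≤ cost A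
  cost-∩ A = +-mono-≤ (monotone P (p∩q⊆p A F)) (≤-reflexive (countOutside-∩ P S⊆π⁻¹F A))

  restrict≤lift : liftRestrictRank P F S ≤ liftRank P S
  restrict≤lift = minOver-greatest ⊤ cost (λ A _ → ≤-trans (minOver-≤ F cost (p∩q⊆q A F)) (cost-∩ A))
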